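{- Let $T$ be a binary tree with $n$ vertices and let $S$ be an $n \times n$ grid point set. Then $T$ admits a restricted RAC$_1$ embedding on $S$.
   Context: An $n \times n$ grid point set is a set $S$ of $n$ points with integer coordinates in $\{1,\dots,n\}^2$ that are in general position, i.e., no two points of $S$ lie on a common horizontal or a common vertical line. A point-set embedding of an $n$-vertex graph $G=(V,E)$ on $S$ consists of a bijection $\mu: V \to S$ and a polyline drawing of $G$ in which each vertex $v$ is drawn at $\mu(v)$ and each edge $uv$ is drawn as a polygonal chain from $\mu(u)$ to $\mu(v)$; edges may not overlap (share a segment of positive length) and may not pass through points representing vertices other than their endpoints. The drawing is RAC if any two crossing edges cross at a right angle. A restricted RAC$_b$ embedding is such an embedding in which every bend lies on a grid point (a point with integer coordinates), every edge segment lies on a grid line (is horizontal or vertical), and every edge has at most $b$ bends. The bijection $\mu$ may be chosen freely. -}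

module Defs where

open import Data.Nat as ℕ using (ℕ; zero; suc)
open import Data.Integer as ℤ using (ℤ; +_)
open import Data.Fin using (Fin)
import Data.Fin as Fin
open import Data.Bool using (Bool; true; false; if_then_else_)
open import Data.List using (List; []; _∷_; _++_; length; map; allFin)
open import Data.Nat.ListAction using (sum)
open import Data.List.Membership.Propositional using (_∈_)
open import Data.List.Relation.Unary.All using (All)
open import Data.List.Relation.Unary.Unique.Propositional using (Unique)
open import Data.List.Relation.Unary.Linked using (Linked)
open import Data.Product using (Σ; ∃; ∃-syntax; _×_; _,_; proj₁; proj₂)
open import Data.Sum using (_⊎_)
open import Data.Empty using (⊥)
open import Function.Bundles using (_↔_; Inverse)
open import Relation.Nullary using (¬_)
open import Relation.Binary.PropositionalEquality using (_≡_; _≢_)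

record Graph (n : ℕ) : Set where
  field
    adj   : Fin n → Fin n → Bool
    sym   : ∀ u v → adj u v ≡ adj v u
    irrefl : ∀ v → adj v v ≡ false

module _ {n : ℕ} (G : Graph n) where
  open Graph G

  Edge : Fin n → Fin n → Set
  Edge u v = adj u v ≡ true

  data Walk : Fin n → Fin n → Set where
    here : ∀ {v} → Walk v v
    step : ∀ {u v w} → Edge u v → Walk v w → Walk u w

  Connected : Set
  Connected = ∀ u v → Walk u v

  HasCycle : Set
  HasCycle = ∃[ v ] ∃[ ws ]
    (2 ℕ.≤ length ws × Unique (v ∷ ws) × Linked Edge (v ∷ ws ++ v ∷ []))

  IsTree : Set
  IsTree = Connected × ¬ HasCycle

  degree : Fin n → ℕ
  degree v = sum (map (λ u → if adj v u then 1 else 0) (allFin n))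

  -- a binary tree: a tree with a root r in which every vertex has at most
  -- two children, i.e. deg r ≤ 2 and deg v ≤ 3 for every other vertex v
  IsBinaryTree : Set
  IsBinaryTree = IsTree × ∃[ r ] (degree r ℕ.≤ 2 × (∀ v → v ≢ r → degree v ℕ.≤ 3))

record GridPointSet (n : ℕ) : Set where
  field
    x : Fin n → ℕ
    y : Fin n → ℕ
    x-range : ∀ i → 1 ℕ.≤ x i × x i ℕ.≤ n
    y-range : ∀ i → 1 ℕ.≤ y i × y i ℕ.≤ n
    x-inj : ∀ i j → x i ≡ x j → i ≡ j
    y-inj : ∀ i j → y i ≡ y j → i ≡ j

Point : Set
Point = ℤ × ℤ

Between : ℤ → ℤ → ℤ → Set
Between a b c = (a ℤ.≤ c × c ℤ.≤ b) ⊎ (b ℤ.≤ c × c ℤ.≤ a)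

Segment : Set
Segment = Point × Point

Horizontal : Segment → Set
Horizontal ((_ , y₁) , (_ , y₂)) = y₁ ≡ y₂

Vertical : Segment → Set
Vertical ((x₁ , _) , (x₂ , _)) = x₁ ≡ x₂

AxisParallel : Segment → Set
AxisParallel s = Horizontal s ⊎ Vertical s

OnSeg : Point → Segment → Set
OnSeg (px , py) ((x₁ , y₁) , (x₂ , y₂)) = Between x₁ x₂ px × Between y₁ y₂ py

InteriorOf : Point → Segment → Set
InteriorOf p (a , b) = OnSeg p (a , b) × p ≢ a × p ≢ b

segments : List Point → List Segment
segments (a ∷ b ∷ r) = (a , b) ∷ segments (b ∷ r)
segments _ = []

OnChain : Point → List Point → Set
OnChain p c = ∃[ s ] (s ∈ segments c × OnSeg p s)

module _ {n : ℕ} (G : Graph n) (S : GridPointSet n) where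
  open GridPointSet S

  -- an edge {u,v} is represented once, by the ordered pair with u < v
  E< : Fin n → Fin n → Set
  E< u v = u Fin.< v × Edge G u v

  record RestrictedRACEmbedding (b : ℕ) : Set where
    field
      -- the bijection μ : V → S (S is indexed by Fin n)
      μ     : Fin n ↔ Fin n
      bends : Fin n → Fin n → List Point

    pos : Fin n → Point
    pos v = (+ x (Inverse.to μ v)) , (+ y (Inverse.to μ v))

    chain : Fin n → Fin n → List Point
    chain u v = pos u ∷ bends u v ++ pos v ∷ []

    field
      few-bends : ∀ u v → E< u v → length (bends u v) ℕ.≤ b
      axis : ∀ u v → E< u v → All AxisParallel (segments (chain u v))
      avoid-vertices : ∀ u v → E< u v → ∀ w → w ≢ u → w ≢ v →
                       ¬ OnChain (pos w) (chain u v)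
      no-overlap : ∀ u v u′ v′ → E< u v → E< u′ v′ → (u , v) ≢ (u′ , v′) →
                   ∀ s s′ → s ∈ segments (chain u v) → s′ ∈ segments (chain u′ v′) →
                   ∀ p q → p ≢ q → OnSeg p s → OnSeg q s → OnSeg p s′ → OnSeg q s′ → ⊥
      rac : ∀ u v u′ v′ → E< u v → E< u′ v′ → (u , v) ≢ (u′ , v′) →
            ∀ p → OnChain p (chain u v) → OnChain p (chain u′ v′) →
            (∃[ w ] ((w ≡ u ⊎ w ≡ v) × (w ≡ u′ ⊎ w ≡ v′) × p ≡ pos w))
            ⊎ (∃[ s ] ∃[ s′ ] (s ∈ segments (chain u v) × s′ ∈ segments (chain u′ v′)
                × InteriorOf p s × InteriorOf p s′
                × ((Horizontal s × Vertical s′) ⊎ (Vertical s × Horizontal s′))))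

-- Root T at r and orient each edge from parent to child (breadth-first layers; acyclicity makes
-- every edge join consecutive layers and gives each vertex a unique parent). Order the points of S
-- by x-coordinate and assign vertices to them in the in-order of the binary tree, so the two
-- children of a vertex lie on opposite sides of it. Draw the edge from a parent t to a child h
-- horizontally from t to (x h, y t), then vertically to h. Vertical segments lie on distinct
-- lines, horizontal segments of different parents lie on distinct lines and those of siblings
-- point in opposite directions, so two edges meet only at a common vertex or where a horizontal
-- segment crosses a vertical one, at a right angle.

module Submission where

open import Defs
open import Data.Bool using (Bool; true; false; if_then_else_; T)
import Data.Bool.Properties as Boolₚ
open import Data.Empty using (⊥; ⊥-elim)
open import Data.Fin as Fin using (Fin; zero; suc; toℕ)
open import Data.Fin.Properties as Finₚ using (_≟_)
open import Data.Integer as ℤ using (ℤ; +_; +<+)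
import Data.Integer.Properties as ℤₚ
open import Data.List using (List; []; _∷_; _++_; _∷ʳ_; length; map; tabulate)
import Data.List.Properties as Listₚ
open import Data.List.Membership.Propositional using (_∈_)
open import Data.List.Relation.Binary.Lex.Strict as Lex using (Lex-<; this; next)
open import Data.List.Relation.Binary.Pointwise using (Pointwise-≡⇒≡)
open import Data.List.Relation.Unary.All as All using (All; []; _∷_)
open import Data.List.Relation.Unary.All.Properties using (++⁺)
open import Data.List.Relation.Unary.Any using (here; there)
open import Data.List.Relation.Unary.Linked using (Linked; []; [-]; _∷_)
open import Data.List.Relation.Unary.Unique.Propositional using (Unique; []; _∷_)
open import Data.Nat as ℕ using (ℕ; zero; suc; _+_; _≤_; _<_; z≤n; s≤s)
open import Data.Nat.ListAction using (sum)
open import Data.Nat.Properties as ℕₚ using (m≤n⇒m≤1+n; ≤-trans)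
open import Data.Product using (Σ; ∃; ∃-syntax; _×_; _,_; proj₁; proj₂)
open import Data.Product.Properties using (×-≡,≡→≡)
open import Data.Sum as Sum using (_⊎_; inj₁; inj₂; [_,_]′)
open import Data.Unit using (tt)
open import Function using (_∘_; id; const)
open import Function.Bundles using (_↔_; Inverse; Equivalence; mk↔ₛ′)
open import Function.Definitions using (Injective)
open import Relation.Binary.Bundles using (StrictTotalOrder)
open import Relation.Binary.Definitions using (tri<; tri≈; tri>)
open import Relation.Binary.PropositionalEquality
open import Relation.Nullary using (¬_; Dec; yes; no; does)
open import Relation.Nullary.Decidable using (_⊎-dec_; _×-dec_; ¬?; isYes; toWitness; fromWitness)
open import Relation.Unary using (Decidable)

count : ∀ {n} → (Fin n → Bool) → ℕ
count {zero}  p = 0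
count {suc n} p = (if p zero then 1 else 0) + count (p ∘ suc)

count-const-true : ∀ n → count {n} (const true) ≡ n
count-const-true zero    = refl
count-const-true (suc n) = cong suc (count-const-true n)

count-mono : ∀ {n} {p q : Fin n → Bool} → (∀ i → T (p i) → T (q i)) → count p ≤ count q
count-mono {zero}          p⇒q = z≤n
count-mono {suc n} {p} {q} p⇒q with p zero | q zero | p⇒q zero
... | false | false | _  = count-mono (p⇒q ∘ suc)
... | false | true  | _  = m≤n⇒m≤1+n (count-mono (p⇒q ∘ suc))
... | true  | true  | _  = s≤s (count-mono (p⇒q ∘ suc))
... | true  | false | p₀⇒q₀ = ⊥-elim (p₀⇒q₀ tt)

count-strict : ∀ {n} {p q : Fin n → Bool} → (∀ i → T (p i) → T (q i)) →
               ∀ j → ¬ T (p j) → T (q j) → count p < count q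
count-strict {suc n} {p} {q} p⇒q zero ¬pj qj with p zero | q zero
... | false | true  = s≤s (count-mono (p⇒q ∘ suc))
... | true  | _     = ⊥-elim (¬pj tt)
count-strict {suc n} {p} {q} p⇒q (suc j) ¬pj qj with p zero | q zero | p⇒q zero
... | false | false | _  = count-strict (p⇒q ∘ suc) j ¬pj qj
... | false | true  | _  = m≤n⇒m≤1+n (count-strict (p⇒q ∘ suc) j ¬pj qj)
... | true  | true  | _  = s≤s (count-strict (p⇒q ∘ suc) j ¬pj qj)
... | true  | false | p₀⇒q₀ = ⊥-elim (p₀⇒q₀ tt)

count-< : ∀ {n} (p : Fin n → Bool) j → ¬ T (p j) → count p < n
count-< {n} p j ¬pj = subst (count p <_) (count-const-true n) (count-strict (λ _ _ → tt) j ¬pj tt)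

length≤count : ∀ {n} (p : Fin n → Bool) {xs} → Unique xs → All (T ∘ p) xs → length xs ≤ count p
length≤count p []                 []          = z≤n
length≤count p {x ∷ xs} (x∉xs ∷ !xs) (px ∷ pxs) =
  ≤-trans (s≤s (length≤count p-x !xs (All.zipWith p-x-holds (x∉xs , pxs))))
          (count-strict p-x⇒p x p-x-fails px)
  where
  p-x : _ → Bool
  p-x i = if does (i ≟ x) then false else p i
  p-x⇒p : ∀ i → T (p-x i) → T (p i)
  p-x⇒p i with i ≟ x
  ... | no _ = λ pi → pi
  p-x-fails : ¬ T (p-x x)
  p-x-fails with x ≟ x
  ... | yes _ = λ ()
  ... | no x≢x = ⊥-elim (x≢x refl)
  p-x-holds : ∀ {i} → x ≢ i × T (p i) → T (p-x i)
  p-x-holds {i} (x≢i , pi) with i ≟ x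
  ... | yes i≡x = ⊥-elim (x≢i (sym i≡x))
  ... | no _    = pi

Least : (ℕ → Set) → ℕ → Set
Least P m = P m × (∀ {k} → P k → m ≤ k)

least-number : ∀ {P : ℕ → Set} → Decidable P → ∀ {b} → P b → ∃ (Least P)
least-number P? {zero} P0 = 0 , P0 , λ _ → z≤n
least-number {P} P? {suc b} Pb with P? 0
... | yes P0 = 0 , P0 , λ _ → z≤n
... | no ¬P0 with least-number (P? ∘ suc) Pb
...   | m , Psm , least = suc m , Psm , above
  where
  above : ∀ {k} → P k → suc m ≤ k
  above {zero}  P0 = ⊥-elim (¬P0 P0)
  above {suc k} Pk = s≤s (least Pk)

linked-∷ʳ : ∀ {A : Set} {R : A → A → Set} xs {x y} → Linked R (xs ++ x ∷ []) → R x y →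
            Linked R ((xs ++ x ∷ []) ++ y ∷ [])
linked-∷ʳ []           _         Rxy = Rxy ∷ [-]
linked-∷ʳ (_ ∷ [])     (R ∷ Rs)  Rxy = R ∷ linked-∷ʳ [] Rs Rxy
linked-∷ʳ (_ ∷ _ ∷ xs) (R ∷ Rs)  Rxy = R ∷ linked-∷ʳ (_ ∷ xs) Rs Rxy

unique-∷ʳ : ∀ {A : Set} xs {x : A} → Unique xs → All (_≢ x) xs → Unique (xs ++ x ∷ [])
unique-∷ʳ []       []          []         = [] ∷ []
unique-∷ʳ (_ ∷ xs) (y∉ ∷ !xs) (y≢x ∷ ≢x) = ++⁺ y∉ (y≢x ∷ []) ∷ unique-∷ʳ xs !xs ≢x

record Rooting {n} (G : Graph n) : Set where
  field
    root   : Fin n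
    parent : Fin n → Fin n
    depth  : Fin n → ℕ

  ChildOf : Fin n → Fin n → Set
  ChildOf c v = c ≢ root × parent c ≡ v

  field
    depth-root    : depth root ≡ 0
    parent-edge   : ∀ {v} → v ≢ root → Edge G (parent v) v
    depth-parent  : ∀ {v} → v ≢ root → depth v ≡ suc (depth (parent v))
    edge-oriented : ∀ {u v} → Edge G u v → ChildOf v u ⊎ ChildOf u v

  childOf? : ∀ c v → Dec (ChildOf c v)
  childOf? c v = ¬? (c ≟ root) ×-dec (parent c ≟ v)

  depth-child : ∀ {c v} → ChildOf c v → depth c ≡ suc (depth v)
  depth-child (c≢root , refl) = depth-parent c≢root

  child-edge : ∀ {c v} → ChildOf c v → Edge G v c
  child-edge (c≢root , refl) = parent-edge c≢root

  depth≡0⇒root : ∀ {v} → depth v ≡ 0 → v ≡ root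
  depth≡0⇒root {v} d≡0 with v ≟ root
  ... | yes v≡root = v≡root
  ... | no v≢root with trans (sym d≡0) (depth-parent v≢root)
  ...   | ()

  depth≡suc⇒≢root : ∀ {v k} → depth v ≡ suc k → v ≢ root
  depth≡suc⇒≢root d≡suc refl with trans (sym d≡suc) depth-root
  ... | ()

  child-not-parent : ∀ {c v} → ChildOf c v → ¬ ChildOf v c
  child-not-parent c→v v→c =
    ℕₚ.<-irrefl (trans (depth-child c→v) (cong suc (depth-child v→c))) (ℕₚ.m<n⇒m<1+n (ℕₚ.n<1+n _))

module _ {n} (G : Graph n) where

  edge-sym : ∀ {u v} → Edge G u v → Edge G v u
  edge-sym {u} {v} e = trans (Graph.sym G v u) e

  edge-irrefl : ∀ {u v} → Edge G u v → u ≢ v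
  edge-irrefl {u} e refl with trans (sym e) (Graph.irrefl G u)
  ... | ()

module BreadthFirst {n} (G : Graph n) (connected : Connected G) (acyclic : ¬ HasCycle G) (r : Fin n)
  where

  Reach : ℕ → Fin n → Set
  Reach zero    v = v ≡ r
  Reach (suc k) v = Reach k v ⊎ ∃[ u ] (Reach k u × Edge G u v)

  reach? : ∀ k → Decidable (Reach k)
  reach? zero    v = v ≟ r
  reach? (suc k) v = reach? k v ⊎-dec Finₚ.any? (λ u → reach? k u ×-dec (Graph.adj G u v Boolₚ.≟ true))

  walk-reach : ∀ {k u v} → Reach k u → Walk G u v → ∃[ m ] Reach m v
  walk-reach {k} Rku here       = k , Rku
  walk-reach     Rku (step e w) = walk-reach (inj₂ (_ , Rku , e)) w

  depth-least-reach : ∀ v → ∃ (Least (λ k → Reach k v))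
  depth-least-reach v = least-number (λ k → reach? k v) (proj₂ (walk-reach {0} refl (connected r v)))

  depth : Fin n → ℕ
  depth v = proj₁ (depth-least-reach v)

  reach-depth : ∀ v → Reach (depth v) v
  reach-depth v = proj₁ (proj₂ (depth-least-reach v))

  depth-least : ∀ {k v} → Reach k v → depth v ≤ k
  depth-least {v = v} = proj₂ (proj₂ (depth-least-reach v))

  depth≡0⇒root : ∀ {v} → depth v ≡ 0 → v ≡ r
  depth≡0⇒root {v} d≡0 = subst (λ k → Reach k v) d≡0 (reach-depth v)

  depth-root : depth r ≡ 0
  depth-root = ℕₚ.n≤0⇒n≡0 (depth-least {0} refl)

  depth≡suc⇒≢root : ∀ {v k} → depth v ≡ suc k → v ≢ r
  depth≡suc⇒≢root d≡suc refl with trans (sym d≡suc) depth-root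
  ... | ()

  depth-edge : ∀ {u v} → Edge G u v → depth v ≤ suc (depth u)
  depth-edge {u} e = depth-least (inj₂ (u , reach-depth u , e))

  shallower⇒≢ : ∀ {v w} → depth v < depth w → v ≢ w
  shallower⇒≢ lt refl = ℕₚ.<-irrefl refl lt

  parent-exists : ∀ {v} → v ≢ r → ∃[ u ] (Edge G u v × depth v ≡ suc (depth u))
  parent-exists {v} v≢r = layer (depth v) refl
    where
    layer : ∀ k → depth v ≡ k → ∃[ u ] (Edge G u v × depth v ≡ suc (depth u))
    layer zero    d≡0 = ⊥-elim (v≢r (depth≡0⇒root d≡0))
    layer (suc k) d≡ with subst (λ j → Reach j v) d≡ (reach-depth v)
    ... | inj₁ Rkv = ⊥-elim (ℕₚ.<-irrefl refl (subst (_≤ k) d≡ (depth-least Rkv)))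
    ... | inj₂ (u , Rku , e) = u , e , trans d≡ (cong suc (sym du≡k))
      where
      du≡k : depth u ≡ k
      du≡k = ℕₚ.≤-antisym (depth-least Rku) (ℕ.s≤s⁻¹ (subst (_≤ suc (depth u)) d≡ (depth-edge e)))

  parent : Fin n → Fin n
  parent v with v ≟ r
  ... | yes _   = r
  ... | no v≢r = proj₁ (parent-exists v≢r)

  parent-spec : ∀ {v} → v ≢ r → Edge G (parent v) v × depth v ≡ suc (depth (parent v))
  parent-spec {v} v≢r with v ≟ r
  ... | yes v≡r  = ⊥-elim (v≢r v≡r)
  ... | no v≢r′ = proj₂ (parent-exists v≢r′)

  -- Climbing from a and b in lockstep until their ancestors meet closes a cycle.
  fork⇒cycle : ∀ k {a b} (M : List (Fin n)) → depth a ≡ k → depth b ≡ k → a ≢ b →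
               All (λ w → k < depth w) M → Unique M → Linked (Edge G) (b ∷ M ++ a ∷ []) →
               HasCycle G
  fork⇒cycle zero    M da db a≢b _ _ _ = ⊥-elim (a≢b (trans (depth≡0⇒root da) (sym (depth≡0⇒root db))))
  fork⇒cycle (suc k) {a} {b} M da db a≢b M-deep M-unique path = close (parent a ≟ parent b)
    where
    ws : List (Fin n)
    ws = b ∷ M ++ a ∷ []
    pa-spec = parent-spec (depth≡suc⇒≢root da)
    pb-spec = parent-spec (depth≡suc⇒≢root db)
    dpa : depth (parent a) ≡ k
    dpa = ℕₚ.suc-injective (trans (sym (proj₂ pa-spec)) da)
    dpb : depth (parent b) ≡ k
    dpb = ℕₚ.suc-injective (trans (sym (proj₂ pb-spec)) db)
    deeper : ∀ {v w} → depth v ≡ suc k → suc k < depth w → v ≢ w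
    deeper dv lt = shallower⇒≢ (subst (_< _) (sym dv) lt)
    ws-deep : All (λ w → k < depth w) ws
    ws-deep = subst (k <_) (sym db) ℕₚ.≤-refl
            ∷ ++⁺ (All.map ℕₚ.<⇒≤ M-deep) (subst (k <_) (sym da) ℕₚ.≤-refl ∷ [])
    ws-unique : Unique ws
    ws-unique = ++⁺ (All.map (deeper db) M-deep) ((a≢b ∘ sym) ∷ [])
              ∷ unique-∷ʳ M M-unique (All.map (λ lt → deeper da lt ∘ sym) M-deep)
    extended : Linked (Edge G) (parent b ∷ ws ++ parent a ∷ [])
    extended = proj₁ pb-spec ∷ linked-∷ʳ (b ∷ M) path (edge-sym G (proj₁ pa-spec))
    close : Dec (parent a ≡ parent b) → HasCycle G
    close (yes pa≡pb) =
      parent a , ws , 2≤|ws| ,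
      All.map (λ lt → shallower⇒≢ (subst (_< _) (sym dpa) lt)) ws-deep ∷ ws-unique ,
      subst (λ z → Linked (Edge G) (z ∷ ws ++ parent a ∷ [])) (sym pa≡pb) extended
      where
      2≤|ws| : 2 ≤ length ws
      2≤|ws| = subst (2 ≤_) (sym (cong suc (Listₚ.length-++-sucʳ M a []))) (s≤s (s≤s z≤n))
    close (no pa≢pb) = fork⇒cycle k ws dpa dpb pa≢pb ws-deep ws-unique extended

  edge-depth-≢ : ∀ {u v} → Edge G u v → depth u ≢ depth v
  edge-depth-≢ e du≡dv =
    acyclic (fork⇒cycle _ [] refl (sym du≡dv) (edge-irrefl G e) [] [] (edge-sym G e ∷ [-]))

  upper-neighbour-unique : ∀ {a b v} → Edge G a v → Edge G b v → depth a ≡ depth b →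
                           depth v ≡ suc (depth a) → a ≡ b
  upper-neighbour-unique {a} {b} {v} ea eb da≡db dv with a ≟ b
  ... | yes a≡b = a≡b
  ... | no a≢b  = ⊥-elim (acyclic (fork⇒cycle _ (v ∷ []) refl (sym da≡db) a≢b
                    (ℕₚ.≤-reflexive (sym dv) ∷ []) ([] ∷ []) (eb ∷ edge-sym G ea ∷ [-])))

  deeper-end-is-child : ∀ {u v} → Edge G u v → depth u < depth v → v ≢ r × parent v ≡ u
  deeper-end-is-child {u} {v} e du<dv =
    v≢r , upper-neighbour-unique (proj₁ pv-spec) e (ℕₚ.suc-injective (trans (sym (proj₂ pv-spec)) dv))
                                 (proj₂ pv-spec)
    where
    dv : depth v ≡ suc (depth u)
    dv = ℕₚ.≤-antisym (depth-edge e) du<dv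
    v≢r = depth≡suc⇒≢root dv
    pv-spec = parent-spec v≢r

  treeRooting : Rooting G
  treeRooting = record
    { root          = r
    ; parent        = parent
    ; depth         = depth
    ; depth-root    = depth-root
    ; parent-edge   = proj₁ ∘ parent-spec
    ; depth-parent  = proj₂ ∘ parent-spec
    ; edge-oriented = oriented
    }
    where
    oriented : ∀ {u v} → Edge G u v → (v ≢ r × parent v ≡ u) ⊎ (u ≢ r × parent u ≡ v)
    oriented {u} {v} e with ℕₚ.<-cmp (depth u) (depth v)
    ... | tri< du<dv _ _ = inj₁ (deeper-end-is-child e du<dv)
    ... | tri≈ _ du≡dv _ = ⊥-elim (edge-depth-≢ e du≡dv)
    ... | tri> _ _ dv<du = inj₂ (deeper-end-is-child (edge-sym G e) dv<du)

data Straddle {a ℓ} {A : Set a} (_<_ : A → A → Set ℓ) (l m r : A) : Set ℓ where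
  ascending  : l < m → m < r → Straddle _<_ l m r
  descending : r < m → m < l → Straddle _<_ l m r

straddle-map : ∀ {a b ℓ₁ ℓ₂} {A : Set a} {B : Set b} {_<_ : A → A → Set ℓ₁} {_<′_ : B → B → Set ℓ₂}
               (f : A → B) → (∀ {x y} → x < y → f x <′ f y) →
               ∀ {l m r} → Straddle _<_ l m r → Straddle _<′_ (f l) (f m) (f r)
straddle-map f mono (ascending  l<m m<r) = ascending  (mono l<m) (mono m<r)
straddle-map f mono (descending r<m m<l) = descending (mono r<m) (mono m<l)

sum-indicators : ∀ {m n} (p : Fin n → Bool) (f : Fin m → Fin n) →
                 sum (map (λ u → if p u then 1 else 0) (tabulate f)) ≡ count (p ∘ f)
sum-indicators {zero}  p f = refl
sum-indicators {suc m} p f = cong ((if p (f zero) then 1 else 0) ℕ.+_) (sum-indicators p (f ∘ suc))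

distinct-neighbours≤degree : ∀ {n} (G : Graph n) v {xs} → Unique xs → All (Edge G v) xs →
                             length xs ≤ degree G v
distinct-neighbours≤degree G v !xs adj =
  subst (_ ≤_) (sym (sum-indicators (Graph.adj G v) id))
        (length≤count (Graph.adj G v) !xs (All.map (Equivalence.from Boolₚ.T-≡) adj))

_<ₗ_ : List ℕ → List ℕ → Set
_<ₗ_ = Lex-< _≡_ _<_

++-<ₗ : ∀ prefix {xs ys} → xs <ₗ ys → (prefix ++ xs) <ₗ (prefix ++ ys)
++-<ₗ []           xs<ys = xs<ys
++-<ₗ (_ ∷ prefix) xs<ys = next refl (++-<ₗ prefix xs<ys)

module Binary {n} {G : Graph n} (R : Rooting G)
  (root-degree : degree G (Rooting.root R) ≤ 2)
  (degree≤3    : ∀ v → v ≢ Rooting.root R → degree G v ≤ 3) where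

  open Rooting R

  at-most-two-children : ∀ {v c₁ c₂ c₃} → ChildOf c₁ v → ChildOf c₂ v → ChildOf c₃ v →
                         c₁ ≢ c₂ → c₁ ≢ c₃ → c₂ ≢ c₃ → ⊥
  at-most-two-children {v} ch₁ ch₂ ch₃ c₁≢c₂ c₁≢c₃ c₂≢c₃ with v ≟ root
  ... | yes refl = ℕₚ.<-irrefl refl (≤-trans
        (distinct-neighbours≤degree G v ((c₁≢c₂ ∷ c₁≢c₃ ∷ []) ∷ (c₂≢c₃ ∷ []) ∷ [] ∷ [])
          (child-edge ch₁ ∷ child-edge ch₂ ∷ child-edge ch₃ ∷ []))
        root-degree)
  ... | no v≢root = ℕₚ.<-irrefl refl (≤-trans
        (distinct-neighbours≤degree G v
          ((p≢ ch₁ ∷ p≢ ch₂ ∷ p≢ ch₃ ∷ []) ∷ (c₁≢c₂ ∷ c₁≢c₃ ∷ []) ∷ (c₂≢c₃ ∷ []) ∷ [] ∷ [])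
          (edge-sym G (parent-edge v≢root) ∷ child-edge ch₁ ∷ child-edge ch₂ ∷ child-edge ch₃ ∷ []))
        (degree≤3 v v≢root))
    where
    p≢ : ∀ {c} → ChildOf c v → parent v ≢ c
    p≢ ch p≡c = child-not-parent ch (v≢root , p≡c)

  -- The tree carries no left/right order: of two siblings, the one with the larger index is right.
  IsRightChild : Fin n → Set
  IsRightChild c = ∃[ c′ ] (c′ Fin.< c × ChildOf c′ (parent c))

  right? : Decidable IsRightChild
  right? c = Finₚ.any? (λ c′ → (c′ Fin.<? c) ×-dec childOf? c′ (parent c))

  some-sibling-right : ∀ {v c₁ c₂} → ChildOf c₁ v → ChildOf c₂ v → c₁ ≢ c₂ →
                       IsRightChild c₁ ⊎ IsRightChild c₂
  some-sibling-right {c₁ = c₁} {c₂} (c₁≢root , refl) (c₂≢root , p₂) c₁≢c₂ with Finₚ.<-cmp c₁ c₂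
  ... | tri< c₁<c₂ _ _ = inj₂ (c₁ , c₁<c₂ , c₁≢root , sym p₂)
  ... | tri≈ _ c₁≡c₂ _ = ⊥-elim (c₁≢c₂ c₁≡c₂)
  ... | tri> _ _ c₂<c₁ = inj₁ (c₂ , c₂<c₁ , c₂≢root , p₂)

  not-both-siblings-right : ∀ {v c₁ c₂} → ChildOf c₁ v → ChildOf c₂ v → c₁ ≢ c₂ →
                            IsRightChild c₁ → IsRightChild c₂ → ⊥
  not-both-siblings-right {v} {c₁} {c₂} ch₁@(_ , p₁) ch₂@(_ , p₂) c₁≢c₂
                          (d₁ , d₁<c₁ , d₁≢root , q₁) (d₂ , d₂<c₂ , d₂≢root , q₂) with d₁ ≟ c₂ | d₂ ≟ c₁
  ... | yes refl | yes refl = Finₚ.<-asym d₁<c₁ d₂<c₂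
  ... | _        | no d₂≢c₁ =
        at-most-two-children ch₁ ch₂ (d₂≢root , trans q₂ p₂) c₁≢c₂ (d₂≢c₁ ∘ sym) (Finₚ.<⇒≢ d₂<c₂ ∘ sym)
  ... | no d₁≢c₂ | _ =
        at-most-two-children ch₁ ch₂ (d₁≢root , trans q₁ p₁) c₁≢c₂ (Finₚ.<⇒≢ d₁<c₁ ∘ sym) (d₁≢c₂ ∘ sym)

  digit : Fin n → ℕ
  digit c with right? c
  ... | yes _ = 2
  ... | no  _ = 0

  siblings-digit-≢ : ∀ {v c₁ c₂} → ChildOf c₁ v → ChildOf c₂ v → c₁ ≢ c₂ → digit c₁ ≢ digit c₂
  siblings-digit-≢ {c₁ = c₁} {c₂} ch₁ ch₂ c₁≢c₂ with right? c₁ | right? c₂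
  ... | yes r₁  | yes r₂  = λ _ → not-both-siblings-right ch₁ ch₂ c₁≢c₂ r₁ r₂
  ... | no ¬r₁  | no ¬r₂  = λ _ → [ ¬r₁ , ¬r₂ ]′ (some-sibling-right ch₁ ch₂ c₁≢c₂)
  ... | yes _   | no _    = λ ()
  ... | no _    | yes _   = λ ()

  path : ℕ → Fin n → List ℕ
  path zero    v = []
  path (suc k) v = path k (parent v) ∷ʳ digit v

  -- Left children get digit 0, right children 2; the final 1 places a vertex between its two
  -- subtrees, so the lexicographic order of keys is the in-order of the tree.
  key : Fin n → List ℕ
  key v = path (depth v) v ∷ʳ 1

  length-path : ∀ k v → length (path k v) ≡ k
  length-path zero    v = refl
  length-path (suc k) v = begin
    length (path k (parent v) ++ digit v ∷ [])  ≡⟨ Listₚ.length-++ (path k (parent v)) ⟩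
    length (path k (parent v)) ℕ.+ 1            ≡⟨ ℕₚ.+-comm _ 1 ⟩
    suc (length (path k (parent v)))            ≡⟨ cong suc (length-path k (parent v)) ⟩
    suc k                                       ∎
    where open ≡-Reasoning

  path-injective : ∀ k {u v} → depth u ≡ k → depth v ≡ k → path k u ≡ path k v → u ≡ v
  path-injective zero    du dv _ = trans (depth≡0⇒root du) (sym (depth≡0⇒root dv))
  path-injective (suc k) {u} {v} du dv paths with u ≟ v
  ... | yes u≡v = u≡v
  ... | no u≢v  = ⊥-elim (siblings-digit-≢ (u≢root , refl) (v≢root , sym pu≡pv) u≢v
                                            (Listₚ.∷ʳ-injectiveʳ (path k (parent u)) _ paths))
    where
    u≢root = depth≡suc⇒≢root du
    v≢root = depth≡suc⇒≢root dv
    pu≡pv : parent u ≡ parent v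
    pu≡pv = path-injective k (ℕₚ.suc-injective (trans (sym (depth-parent u≢root)) du))
                             (ℕₚ.suc-injective (trans (sym (depth-parent v≢root)) dv))
                             (Listₚ.∷ʳ-injectiveˡ (path k (parent u)) _ paths)

  key-injective : ∀ {u v} → key u ≡ key v → u ≡ v
  key-injective {u} {v} keys =
    path-injective (depth u) refl (sym du≡dv)
                   (subst (λ k → path (depth u) u ≡ path k v) (sym du≡dv) paths)
    where
    paths = Listₚ.∷ʳ-injectiveˡ (path (depth u) u) (path (depth v) v) keys
    du≡dv : depth u ≡ depth v
    du≡dv = trans (sym (length-path (depth u) u)) (trans (cong length paths) (length-path (depth v) v))

  digit-left : ∀ {c} → ¬ IsRightChild c → digit c ≡ 0
  digit-left {c} ¬right with right? c
  ... | yes right = ⊥-elim (¬right right)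
  ... | no _      = refl

  digit-right : ∀ {c} → IsRightChild c → digit c ≡ 2
  digit-right {c} right with right? c
  ... | yes _      = refl
  ... | no ¬right = ⊥-elim (¬right right)

  key-child : ∀ {c v} → ChildOf c v → key c ≡ path (depth v) v ++ digit c ∷ 1 ∷ []
  key-child {c} (c≢root , refl) =
    trans (cong (λ k → path k c ∷ʳ 1) (depth-parent c≢root))
          (Listₚ.∷ʳ-++ (path (depth (parent c)) (parent c)) (digit c) (1 ∷ []))

  left-child-key : ∀ {c v} → ChildOf c v → ¬ IsRightChild c → key c <ₗ key v
  left-child-key {v = v} ch ¬right rewrite key-child ch | digit-left ¬right =
    ++-<ₗ (path (depth v) v) (this (s≤s z≤n))

  right-child-key : ∀ {c v} → ChildOf c v → IsRightChild c → key v <ₗ key c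
  right-child-key {v = v} ch right rewrite key-child ch | digit-right right =
    ++-<ₗ (path (depth v) v) (this (s≤s (s≤s z≤n)))

  siblings-straddle : ∀ {v c₁ c₂} → ChildOf c₁ v → ChildOf c₂ v → c₁ ≢ c₂ →
                      Straddle (λ u w → key u <ₗ key w) c₁ v c₂
  siblings-straddle {c₁ = c₁} {c₂} ch₁ ch₂ c₁≢c₂ with right? c₁ | right? c₂
  ... | yes r₁ | yes r₂ = ⊥-elim (not-both-siblings-right ch₁ ch₂ c₁≢c₂ r₁ r₂)
  ... | no ¬r₁ | no ¬r₂ = ⊥-elim ([ ¬r₁ , ¬r₂ ]′ (some-sibling-right ch₁ ch₂ c₁≢c₂))
  ... | no ¬r₁ | yes r₂ = ascending  (left-child-key ch₁ ¬r₁) (right-child-key ch₂ r₂)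
  ... | yes r₁ | no ¬r₂ = descending (left-child-key ch₂ ¬r₂) (right-child-key ch₁ r₁)

injective⇒surjective : ∀ {n} (f : Fin n → Fin n) → Injective _≡_ _≡_ f → ∀ j → ∃[ i ] f i ≡ j
injective⇒surjective {suc m} f f-inj j with Finₚ.any? (λ i → f i ≟ j)
... | yes hit = hit
... | no miss = ⊥-elim (ℕₚ.<-irrefl refl (Finₚ.injective⇒≤ f-without-j-inj))
  where
  j≢f : ∀ i → j ≢ f i
  j≢f i j≡fi = miss (i , sym j≡fi)
  f-without-j-inj : Injective _≡_ _≡_ (λ i → Fin.punchOut (j≢f i))
  f-without-j-inj eq = f-inj (Finₚ.punchOut-injective (j≢f _) (j≢f _) eq)

injective⇒↔ : ∀ {n} (f : Fin n → Fin n) → Injective _≡_ _≡_ f → Fin n ↔ Fin n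
injective⇒↔ f f-inj = mk↔ₛ′ f (proj₁ ∘ onto) (proj₂ ∘ onto) (λ i → f-inj (proj₂ (onto (f i))))
  where onto = injective⇒surjective f f-inj

module Ranking {a ℓ₁ ℓ₂} (O : StrictTotalOrder a ℓ₁ ℓ₂) {n}
  (key : Fin n → StrictTotalOrder.Carrier O)
  (key-injective : Injective _≡_ (StrictTotalOrder._≈_ O) key) where

  open StrictTotalOrder O using (_<?_; compare; module Eq)
    renaming (_<_ to _≺_; trans to ≺-trans; irrefl to ≺-irrefl)

  rank : Fin n → ℕ
  rank v = count (λ u → isYes (key u <? key v))

  rank-< : ∀ {u v} → key u ≺ key v → rank u ℕ.< rank v
  rank-< {u} u<v = count-strict (λ _ w<u → fromWitness (≺-trans (toWitness w<u) u<v)) u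
                                (≺-irrefl Eq.refl ∘ toWitness) (fromWitness u<v)

  rank<n : ∀ v → rank v ℕ.< n
  rank<n v = count-< _ v (≺-irrefl Eq.refl ∘ toWitness)

  rank-injective : ∀ {u v} → rank u ≡ rank v → u ≡ v
  rank-injective {u} {v} ru≡rv with compare (key u) (key v)
  ... | tri< u<v _ _ = ⊥-elim (ℕₚ.<-irrefl ru≡rv (rank-< u<v))
  ... | tri≈ _ u≈v _ = key-injective u≈v
  ... | tri> _ _ v<u = ⊥-elim (ℕₚ.<-irrefl (sym ru≡rv) (rank-< v<u))

module _ {n} (S : GridPointSet n) where
  open GridPointSet S

  column : Fin n → Fin n
  column i = Fin.fromℕ< (pred< (x-range i))
    where
    pred< : ∀ {m} → 1 ≤ m × m ≤ n → ℕ.pred m < n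
    pred< {suc m} (_ , m<n) = m<n

  suc-column : ∀ i → suc (toℕ (column i)) ≡ x i
  suc-column i = trans (cong suc (Finₚ.toℕ-fromℕ< _)) (suc-pred (proj₁ (x-range i)))
    where
    suc-pred : ∀ {m} → 1 ≤ m → suc (ℕ.pred m) ≡ m
    suc-pred {suc m} _ = refl

  column-injective : Injective _≡_ _≡_ column
  column-injective {i} {j} eq =
    x-inj i j (trans (sym (suc-column i)) (trans (cong (suc ∘ toℕ) eq) (suc-column j)))

  order-preserving-placement : ∀ {a ℓ₁ ℓ₂} (O : StrictTotalOrder a ℓ₁ ℓ₂)
    (key : Fin n → StrictTotalOrder.Carrier O) → Injective _≡_ (StrictTotalOrder._≈_ O) key →
    Σ (Fin n ↔ Fin n) λ μ → ∀ {u v} → StrictTotalOrder._<_ O (key u) (key v) →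
                                        x (Inverse.to μ u) < x (Inverse.to μ v)
  order-preserving-placement O key key-injective = injective⇒↔ place place-injective , place-<
    where
    open Ranking O key key-injective
    column↔ = injective⇒↔ column column-injective
    place : Fin n → Fin n
    place v = Inverse.from column↔ (Fin.fromℕ< (rank<n v))
    x-place : ∀ v → x (place v) ≡ suc (rank v)
    x-place v = begin
      x (place v)                            ≡⟨ suc-column (place v) ⟨
      suc (toℕ (column (place v)))           ≡⟨ cong (suc ∘ toℕ) (Inverse.strictlyInverseˡ column↔ _) ⟩
      suc (toℕ (Fin.fromℕ< (rank<n v)))      ≡⟨ cong suc (Finₚ.toℕ-fromℕ< _) ⟩
      suc (rank v)                           ∎
      where open ≡-Reasoning
    place-injective : Injective _≡_ _≡_ place
    place-injective {u} {v} eq =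
      rank-injective (ℕₚ.suc-injective (trans (sym (x-place u)) (trans (cong x eq) (x-place v))))
    place-< : ∀ {u v} → StrictTotalOrder._<_ O (key u) (key v) → x (place u) < x (place v)
    place-< {u} {v} u<v = subst₂ _<_ (sym (x-place u)) (sym (x-place v)) (s≤s (rank-< u<v))

between-self : ∀ {a c} → Between a a c → c ≡ a
between-self (inj₁ (a≤c , c≤a)) = ℤₚ.≤-antisym c≤a a≤c
between-self (inj₂ (a≤c , c≤a)) = ℤₚ.≤-antisym c≤a a≤c

between-sym : ∀ {a b c} → Between a b c → Between b a c
between-sym (inj₁ c∈[a,b]) = inj₂ c∈[a,b]
between-sym (inj₂ c∈[b,a]) = inj₁ c∈[b,a]

between-endpoint : ∀ a b → Between a b b
between-endpoint a b with ℤₚ.≤-total a b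
... | inj₁ a≤b = inj₁ (a≤b , ℤₚ.≤-refl)
... | inj₂ b≤a = inj₂ (ℤₚ.≤-refl , b≤a)

between-opposite⇒≡ : ∀ {l m r c} → l ℤ.< m → m ℤ.< r → Between m l c → Between m r c → c ≡ m
between-opposite⇒≡ l<m _ (inj₁ (m≤c , c≤l)) _ =
  ⊥-elim (ℤₚ.<-irrefl refl (ℤₚ.<-≤-trans l<m (ℤₚ.≤-trans m≤c c≤l)))
between-opposite⇒≡ _ _ (inj₂ (_ , c≤m)) (inj₁ (m≤c , _)) = ℤₚ.≤-antisym c≤m m≤c
between-opposite⇒≡ _ m<r (inj₂ _) (inj₂ (r≤c , c≤m)) =
  ⊥-elim (ℤₚ.<-irrefl refl (ℤₚ.<-≤-trans m<r (ℤₚ.≤-trans r≤c c≤m)))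

straddle-between⇒≡ : ∀ {l m r c} → Straddle ℤ._<_ l m r → Between m l c → Between m r c → c ≡ m
straddle-between⇒≡ (ascending  l<m m<r) c∈ml c∈mr = between-opposite⇒≡ l<m m<r c∈ml c∈mr
straddle-between⇒≡ (descending r<m m<l) c∈ml c∈mr = between-opposite⇒≡ r<m m<l c∈mr c∈ml

module OrthogonalDrawing {n} {G : Graph n} (S : GridPointSet n) (R : Rooting G) (μ : Fin n ↔ Fin n)
  where
  open GridPointSet S
  open Rooting R

  X Y : Fin n → ℤ
  X v = + x (Inverse.to μ v)
  Y v = + y (Inverse.to μ v)

  P : Fin n → Point
  P v = X v , Y v

  μ-injective : ∀ {u v} → Inverse.to μ u ≡ Inverse.to μ v → u ≡ v
  μ-injective {u} {v} eq = trans (sym (Inverse.strictlyInverseʳ μ u))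
                                 (trans (cong (Inverse.from μ) eq) (Inverse.strictlyInverseʳ μ v))

  X-injective : ∀ {u v} → X u ≡ X v → u ≡ v
  X-injective eq = μ-injective (x-inj _ _ (ℤₚ.+-injective eq))

  Y-injective : ∀ {u v} → Y u ≡ Y v → u ≡ v
  Y-injective eq = μ-injective (y-inj _ _ (ℤₚ.+-injective eq))

  corner : Fin n → Point
  corner h = X h , Y (parent h)

  HorizontalPiece VerticalPiece : Fin n → Segment → Set
  HorizontalPiece h s = s ≡ (P (parent h) , corner h) ⊎ s ≡ (corner h , P (parent h))
  VerticalPiece   h s = s ≡ (corner h , P h) ⊎ s ≡ (P h , corner h)

  Piece : Fin n → Segment → Set
  Piece h s = HorizontalPiece h s ⊎ VerticalPiece h s

  bend : Fin n → Fin n → Point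
  bend u v with childOf? v u
  ... | yes _ = X v , Y u
  ... | no  _ = X u , Y v

  bends : Fin n → Fin n → List Point
  bends u v = bend u v ∷ []

  chain : Fin n → Fin n → List Point
  chain u v = P u ∷ bends u v ++ P v ∷ []

  chain-axis-parallel : ∀ u v → All AxisParallel (segments (chain u v))
  chain-axis-parallel u v with childOf? v u
  ... | yes _ = inj₁ refl ∷ inj₂ refl ∷ []
  ... | no  _ = inj₂ refl ∷ inj₁ refl ∷ []

  record DrawnEdge (u v : Fin n) : Set where
    field
      head      : Fin n
      head≢root : head ≢ root
      ends      : (parent head ≡ u × head ≡ v) ⊎ (parent head ≡ v × head ≡ u)
      pieces    : ∀ {s} → s ∈ segments (chain u v) → Piece head s

    tail-end : parent head ≡ u ⊎ parent head ≡ v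
    tail-end = Sum.map proj₁ proj₁ ends

    head-end : head ≡ u ⊎ head ≡ v
    head-end = [ inj₂ ∘ proj₂ , inj₁ ∘ proj₂ ]′ ends

  pieces-from-parent : ∀ {h} → h ≢ root → ∀ {s} → s ∈ segments (chain (parent h) h) → Piece h s
  pieces-from-parent {h} h≢root with childOf? h (parent h)
  ... | yes _   = λ { (here refl) → inj₁ (inj₁ refl) ; (there (here refl)) → inj₂ (inj₁ refl) }
  ... | no ¬h→p = ⊥-elim (¬h→p (h≢root , refl))

  pieces-to-parent : ∀ {h} → h ≢ root → ∀ {s} → s ∈ segments (chain h (parent h)) → Piece h s
  pieces-to-parent {h} h≢root with childOf? (parent h) h
  ... | yes p→h = ⊥-elim (child-not-parent (h≢root , refl) p→h)
  ... | no _    = λ { (here refl) → inj₂ (inj₂ refl) ; (there (here refl)) → inj₁ (inj₂ refl) }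

  drawn : ∀ {u v} → Edge G u v → DrawnEdge u v
  drawn e with edge-oriented e
  ... | inj₁ (v≢root , refl) = record
        { head = _ ; head≢root = v≢root ; ends = inj₁ (refl , refl)
        ; pieces = pieces-from-parent v≢root }
  ... | inj₂ (u≢root , refl) = record
        { head = _ ; head≢root = u≢root ; ends = inj₂ (refl , refl)
        ; pieces = pieces-to-parent u≢root }

  OnHorizontal OnVertical : Fin n → Point → Set
  OnHorizontal h (px , py) = py ≡ Y (parent h) × Between (X (parent h)) (X h) px
  OnVertical   h (px , py) = px ≡ X h × Between (Y (parent h)) (Y h) py

  on-horizontal : ∀ {h s p} → HorizontalPiece h s → OnSeg p s → OnHorizontal h p
  on-horizontal (inj₁ refl) (x∈ , y∈) = between-self y∈ , x∈
  on-horizontal (inj₂ refl) (x∈ , y∈) = between-self y∈ , between-sym x∈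

  on-vertical : ∀ {h s p} → VerticalPiece h s → OnSeg p s → OnVertical h p
  on-vertical (inj₁ refl) (x∈ , y∈) = between-self x∈ , y∈
  on-vertical (inj₂ refl) (x∈ , y∈) = between-self x∈ , between-sym y∈

  horizontal-piece : ∀ {h s} → HorizontalPiece h s → Horizontal s
  horizontal-piece (inj₁ refl) = refl
  horizontal-piece (inj₂ refl) = refl

  vertical-piece : ∀ {h s} → VerticalPiece h s → Vertical s
  vertical-piece (inj₁ refl) = refl
  vertical-piece (inj₂ refl) = refl

  interior-horizontal : ∀ {h s p} → HorizontalPiece h s → OnSeg p s →
                        p ≢ P (parent h) → p ≢ corner h → InteriorOf p s
  interior-horizontal (inj₁ refl) on ≢tail ≢corner = on , ≢tail , ≢corner
  interior-horizontal (inj₂ refl) on ≢tail ≢corner = on , ≢corner , ≢tail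

  interior-vertical : ∀ {h s p} → VerticalPiece h s → OnSeg p s →
                      p ≢ P h → p ≢ corner h → InteriorOf p s
  interior-vertical (inj₁ refl) on ≢head ≢corner = on , ≢corner , ≢head
  interior-vertical (inj₂ refl) on ≢head ≢corner = on , ≢head , ≢corner

  distinct-edges⇒distinct-heads : ∀ {u v u′ v′} → u Fin.< v → u′ Fin.< v′ → (u , v) ≢ (u′ , v′) →
    (d : DrawnEdge u v) (d′ : DrawnEdge u′ v′) → DrawnEdge.head d ≢ DrawnEdge.head d′
  distinct-edges⇒distinct-heads u<v u′<v′ uv≢u′v′ d d′ refl with DrawnEdge.ends d | DrawnEdge.ends d′
  ... | inj₁ (refl , refl) | inj₁ (refl , refl) = uv≢u′v′ refl
  ... | inj₂ (refl , refl) | inj₂ (refl , refl) = uv≢u′v′ refl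
  ... | inj₁ (refl , refl) | inj₂ (refl , refl) = Finₚ.<-asym u<v u′<v′
  ... | inj₂ (refl , refl) | inj₁ (refl , refl) = Finₚ.<-asym u<v u′<v′

  off-ends : ∀ {u v w z : Fin n} → w ≢ u → w ≢ v → z ≡ u ⊎ z ≡ v → w ≢ z
  off-ends w≢u _   (inj₁ z≡u) w≡z = w≢u (trans w≡z z≡u)
  off-ends _   w≢v (inj₂ z≡v) w≡z = w≢v (trans w≡z z≡v)

  avoids-vertices : ∀ {u v} (d : DrawnEdge u v) w → w ≢ u → w ≢ v → ¬ OnChain (P w) (chain u v)
  avoids-vertices d w w≢u w≢v (s , s∈ , on) with DrawnEdge.pieces d s∈
  ... | inj₁ hor = off-ends w≢u w≢v (DrawnEdge.tail-end d) (Y-injective (proj₁ (on-horizontal hor on)))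
  ... | inj₂ ver = off-ends w≢u w≢v (DrawnEdge.head-end d) (X-injective (proj₁ (on-vertical ver on)))

  horizontal-vertical-point : ∀ {h₁ h₂ p} → OnHorizontal h₁ p → OnVertical h₂ p →
                              p ≡ (X h₂ , Y (parent h₁))
  horizontal-vertical-point (py≡ , _) (px≡ , _) = ×-≡,≡→≡ (px≡ , py≡)

  module _ (siblings-apart : ∀ {v c₁ c₂} → ChildOf c₁ v → ChildOf c₂ v → c₁ ≢ c₂ →
                             Straddle ℤ._<_ (X c₁) (X v) (X c₂)) where

    horizontals-meet-at-parent : ∀ {h₁ h₂ p} → h₁ ≢ root → h₂ ≢ root → h₁ ≢ h₂ →
      OnHorizontal h₁ p → OnHorizontal h₂ p → parent h₁ ≡ parent h₂ × p ≡ P (parent h₁)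
    horizontals-meet-at-parent {h₁} {h₂} {px , py} h₁≢root h₂≢root h₁≢h₂ (py₁ , px∈₁) (py₂ , px∈₂) =
      siblings , ×-≡,≡→≡ (px≡ , py₁)
      where
      siblings : parent h₁ ≡ parent h₂
      siblings = Y-injective (trans (sym py₁) py₂)
      px≡ : px ≡ X (parent h₁)
      px≡ = straddle-between⇒≡ (siblings-apart (h₁≢root , refl) (h₂≢root , sym siblings) h₁≢h₂)
              px∈₁ (subst (λ t → Between (X t) (X h₂) px) (sym siblings) px∈₂)

    horizontal-meets-vertical : ∀ {h₁ h₂ s s′ p} → h₁ ≢ root → h₂ ≢ root → h₁ ≢ h₂ →
      HorizontalPiece h₁ s → VerticalPiece h₂ s′ → OnSeg p s → OnSeg p s′ →
      (parent h₁ ≡ h₂ × p ≡ P h₂) ⊎ (InteriorOf p s × InteriorOf p s′)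
    horizontal-meets-vertical {h₁} {h₂} {p = px , py} h₁≢root h₂≢root h₁≢h₂ hor ver on on′
      with on-horizontal hor on | on-vertical ver on′ | parent h₁ ≟ h₂
    ... | py≡ , _ | px≡ , _ | yes refl = inj₁ (refl , ×-≡,≡→≡ (px≡ , py≡))
    ... | py≡ , px∈ | px≡ , _ | no tail≢h₂ =
          inj₂ ( interior-horizontal hor on
                   (tail≢h₂ ∘ sym ∘ X-injective ∘ trans (sym px≡) ∘ cong proj₁)
                   (λ eq → h₁≢h₂ (X-injective (trans (sym (cong proj₁ eq)) px≡)))
               , interior-vertical ver on′
                   (tail≢h₂ ∘ Y-injective ∘ trans (sym py≡) ∘ cong proj₂)
                   off-corner )
      where
      on-corner : ∀ {q} → q ≡ corner h₂ → OnHorizontal h₂ q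
      on-corner refl = refl , between-endpoint _ _
      off-corner : (px , py) ≢ corner h₂
      off-corner p≡corner = tail≢h₂ (sym (X-injective (trans (sym px≡) (cong proj₁ (proj₂ meet)))))
        where meet = horizontals-meet-at-parent h₁≢root h₂≢root h₁≢h₂ (py≡ , px∈) (on-corner p≡corner)

    pieces-meet-at-most-once : ∀ {h₁ h₂ s s′ p q} → h₁ ≢ root → h₂ ≢ root → h₁ ≢ h₂ →
      Piece h₁ s → Piece h₂ s′ → OnSeg p s → OnSeg p s′ → OnSeg q s → OnSeg q s′ → p ≡ q
    pieces-meet-at-most-once {h₁} {s = s} {s′} h₁≢root h₂≢root h₁≢h₂ (inj₁ hor) (inj₁ hor′)
                             p∈ p∈′ q∈ q∈′ =
      trans (at-parent p∈ p∈′) (sym (at-parent q∈ q∈′))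
      where
      at-parent : ∀ {z} → OnSeg z s → OnSeg z s′ → z ≡ P (parent h₁)
      at-parent z∈ z∈′ = proj₂ (horizontals-meet-at-parent h₁≢root h₂≢root h₁≢h₂
                                  (on-horizontal hor z∈) (on-horizontal hor′ z∈′))
    pieces-meet-at-most-once _ _ _ (inj₁ hor) (inj₂ ver′) p∈ p∈′ q∈ q∈′ =
      trans (horizontal-vertical-point (on-horizontal hor p∈) (on-vertical ver′ p∈′))
       (sym (horizontal-vertical-point (on-horizontal hor q∈) (on-vertical ver′ q∈′)))
    pieces-meet-at-most-once _ _ _ (inj₂ ver) (inj₁ hor′) p∈ p∈′ q∈ q∈′ =
      trans (horizontal-vertical-point (on-horizontal hor′ p∈′) (on-vertical ver p∈))
       (sym (horizontal-vertical-point (on-horizontal hor′ q∈′) (on-vertical ver q∈)))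
    pieces-meet-at-most-once _ _ h₁≢h₂ (inj₂ ver) (inj₂ ver′) p∈ p∈′ _ _ =
      ⊥-elim (h₁≢h₂ (X-injective (trans (sym (proj₁ (on-vertical ver p∈)))
                                        (proj₁ (on-vertical ver′ p∈′)))))

    MeetProperly : Fin n → Fin n → Fin n → Fin n → Point → Set
    MeetProperly u v u′ v′ p =
      (∃[ w ] ((w ≡ u ⊎ w ≡ v) × (w ≡ u′ ⊎ w ≡ v′) × p ≡ P w))
      ⊎ (∃[ s ] ∃[ s′ ] (s ∈ segments (chain u v) × s′ ∈ segments (chain u′ v′)
          × InteriorOf p s × InteriorOf p s′
          × ((Horizontal s × Vertical s′) ⊎ (Vertical s × Horizontal s′))))

    meet-properly : ∀ {u v u′ v′} (d : DrawnEdge u v) (d′ : DrawnEdge u′ v′) →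
      DrawnEdge.head d ≢ DrawnEdge.head d′ →
      ∀ p → OnChain p (chain u v) → OnChain p (chain u′ v′) → MeetProperly u v u′ v′ p
    meet-properly {u} {v} {u′} {v′} d d′ h≢h′ p (s , s∈ , on) (s′ , s′∈ , on′) =
      meet (D.pieces s∈) (D′.pieces s′∈)
      where
      module D  = DrawnEdge d
      module D′ = DrawnEdge d′
      meet : Piece D.head s → Piece D′.head s′ → MeetProperly u v u′ v′ p
      meet (inj₁ hor) (inj₁ hor′) =
        inj₁ ( _ , D.tail-end , subst (λ t → t ≡ u′ ⊎ t ≡ v′) (sym (proj₁ at-parent)) D′.tail-end
             , proj₂ at-parent )
        where
        at-parent = horizontals-meet-at-parent D.head≢root D′.head≢root h≢h′
                      (on-horizontal hor on) (on-horizontal hor′ on′)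
      meet (inj₂ ver) (inj₂ ver′) =
        ⊥-elim (h≢h′ (X-injective (trans (sym (proj₁ (on-vertical ver on)))
                                          (proj₁ (on-vertical ver′ on′)))))
      meet (inj₁ hor) (inj₂ ver′) = Sum.map
        (λ (tail≡h′ , p≡) → _ , subst (λ t → t ≡ u ⊎ t ≡ v) tail≡h′ D.tail-end , D′.head-end , p≡)
        (λ (int , int′) → s , s′ , s∈ , s′∈ , int , int′ , inj₁ (horizontal-piece hor , vertical-piece ver′))
        (horizontal-meets-vertical D.head≢root D′.head≢root h≢h′ hor ver′ on on′)
      meet (inj₂ ver) (inj₁ hor′) = Sum.map
        (λ (tail≡h , p≡) → _ , D.head-end , subst (λ t → t ≡ u′ ⊎ t ≡ v′) tail≡h D′.tail-end , p≡)
        (λ (int′ , int) → s , s′ , s∈ , s′∈ , int , int′ , inj₂ (vertical-piece ver , horizontal-piece hor′))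
        (horizontal-meets-vertical D′.head≢root D.head≢root (h≢h′ ∘ sym) hor′ ver on′ on)

    edges-meet-at-most-once : ∀ {u v u′ v′} → E< G S u v → E< G S u′ v′ → (u , v) ≢ (u′ , v′) →
      ∀ {s s′} → s ∈ segments (chain u v) → s′ ∈ segments (chain u′ v′) →
      ∀ {p q} → OnSeg p s → OnSeg q s → OnSeg p s′ → OnSeg q s′ → p ≡ q
    edges-meet-at-most-once (u<v , e) (u′<v′ , e′) uv≢u′v′ s∈ s′∈ p∈ q∈ p∈′ q∈′ =
      pieces-meet-at-most-once (DrawnEdge.head≢root (drawn e)) (DrawnEdge.head≢root (drawn e′))
        (distinct-edges⇒distinct-heads u<v u′<v′ uv≢u′v′ (drawn e) (drawn e′))
        (DrawnEdge.pieces (drawn e) s∈) (DrawnEdge.pieces (drawn e′) s′∈) p∈ p∈′ q∈ q∈′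

    edges-meet-properly : ∀ {u v u′ v′} → E< G S u v → E< G S u′ v′ → (u , v) ≢ (u′ , v′) →
      ∀ p → OnChain p (chain u v) → OnChain p (chain u′ v′) → MeetProperly u v u′ v′ p
    edges-meet-properly (u<v , e) (u′<v′ , e′) uv≢u′v′ =
      meet-properly (drawn e) (drawn e′)
        (distinct-edges⇒distinct-heads u<v u′<v′ uv≢u′v′ (drawn e) (drawn e′))

    embedding : RestrictedRACEmbedding G S 1
    embedding = record
      { μ              = μ
      ; bends          = bends
      ; few-bends      = λ _ _ _ → s≤s z≤n
      ; axis           = λ u v _ → chain-axis-parallel u v
      ; avoid-vertices = λ _ _ (_ , e) → avoids-vertices (drawn e)
      ; no-overlap     = λ _ _ _ _ e e′ uv≢u′v′ _ _ s∈ s′∈ _ _ p≢q p∈ q∈ p∈′ q∈′ →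
                           p≢q (edges-meet-at-most-once e e′ uv≢u′v′ s∈ s′∈ p∈ q∈ p∈′ q∈′)
      ; rac            = λ _ _ _ _ → edges-meet-properly
      }

theorem1 : (n : ℕ) (T : Graph n) → IsBinaryTree T →
           (S : GridPointSet n) → RestrictedRACEmbedding T S 1
theorem1 n T ((connected , acyclic) , r , root-degree , degree≤3) S =
  OrthogonalDrawing.embedding S R μ
    (λ ch₁ ch₂ c₁≢c₂ → straddle-map (X μ) (+<+ ∘ x-order) (siblings-straddle ch₁ ch₂ c₁≢c₂))
  where
  R = BreadthFirst.treeRooting T connected acyclic r
  open Binary R root-degree degree≤3 using (key; key-injective; siblings-straddle)
  open OrthogonalDrawing S R using (X)
  lexicographic = Lex.<-strictTotalOrder ℕₚ.<-strictTotalOrder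
  placed = order-preserving-placement S lexicographic key (key-injective ∘ Pointwise-≡⇒≡)
  μ = proj₁ placed
  x-order = proj₂ placed
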